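{- If $G$ is a simple connected graph with diameter $d$, then $\left\lceil \frac{d+2}{2}\right\rceil\le\rho_{\mathrm{opt}}(G)$.
   Context: A pebble distribution on $G$ is a function $p:V(G)\to\mathbb{Z}_{\ge0}$, of size $\sum_v p(v)$. The pebbling move $(v,v\to u)$ (for an edge $\{v,u\}$) removes two pebbles from $v$ and adds one at $u$; the strict rubbling move $(v,w\to u)$ (for $v\ne w$, both adjacent to $u$) removes one pebble from each of $v,w$ and adds one at $u$. A vertex is reachable from $p$ if some finite sequence of these moves, keeping all intermediate distributions nonnegative, puts at least one pebble on it. The optimal rubbling number $\rho_{\mathrm{opt}}(G)$ is the minimum size of a pebble distribution from which every vertex of $G$ is reachable. -}

module Defs where

open import Level using (0ℓ)
open import Data.Nat using (ℕ; zero; suc; _+_; _≤_; _<_)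
open import Data.Fin using (Fin) renaming (zero to fzero; suc to fsuc)
open import Data.Product using (Σ; ∃; _×_; _,_)
open import Data.Sum using (_⊎_)
open import Relation.Nullary using (¬_)
open import Relation.Binary.PropositionalEquality using (_≡_; _≢_)
open import Relation.Binary.Construct.Closure.ReflexiveTransitive using (Star)
open import Data.Fin.Properties using (_≟_)
open import Relation.Nullary using (yes; no)

record Graph (n : ℕ) : Set₁ where
  field
    Adj     : Fin n → Fin n → Set
    symmetric   : ∀ {u v} → Adj u v → Adj v u
    irreflexive : ∀ {u} → ¬ Adj u u
open Graph public

data Walk {n : ℕ} (G : Graph n) : Fin n → Fin n → ℕ → Set where
  nil  : ∀ {u} → Walk G u u zero
  cons : ∀ {u v w k} → Adj G u v → Walk G v w k → Walk G u w (suc k)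

Dist : ∀ {n} → Graph n → Fin n → Fin n → ℕ → Set
Dist G u v k = Walk G u v k × (∀ j → j < k → ¬ Walk G u v j)

Connected : ∀ {n} → Graph n → Set
Connected G = ∀ u v → ∃ λ k → Walk G u v k

HasDiameter : ∀ {n} → Graph n → ℕ → Set
HasDiameter {n} G d =
  (∀ u v k → Dist G u v k → k ≤ d) × (Σ (Fin n) λ u → Σ (Fin n) λ v → Dist G u v d)

Distribution : ℕ → Set
Distribution n = Fin n → ℕ

size : ∀ {n} → Distribution n → ℕ
size {zero}  p = 0
size {suc n} p = p fzero + size (λ i → p (fsuc i))

add1 : ∀ {n} → Fin n → Distribution n → Distribution n
add1 u p x with x ≟ u
... | yes _ = suc (p x)
... | no  _ = p x

-- Removing pebbles is
-- expressed by giving the pre-move distribution explicitly, which keeps all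
-- intermediate distributions nonnegative automatically.
data Move {n : ℕ} (G : Graph n) : Distribution n → Distribution n → Set where
  pebbling : ∀ {u v} (r : Distribution n) → Adj G v u →
             Move G (add1 v (add1 v r)) (add1 u r)
  rubbling : ∀ {u v w} (r : Distribution n) → v ≢ w → Adj G v u → Adj G w u →
             Move G (add1 v (add1 w r)) (add1 u r)

-- Move is stated on functions; we close under pointwise equality.
_≗_ : ∀ {n} → Distribution n → Distribution n → Set
p ≗ q = ∀ x → p x ≡ q x

Step : ∀ {n} → Graph n → Distribution n → Distribution n → Set
Step G p q = Σ _ λ p' → Σ _ λ q' → p ≗ p' × Move G p' q' × q' ≗ q

Reachable : ∀ {n} → Graph n → Distribution n → Fin n → Set
Reachable G p v = Σ _ λ q → Star (Step G) p q × (1 ≤ q v)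

Solvable : ∀ {n} → Graph n → Distribution n → Set
Solvable G p = ∀ v → Reachable G p v

IsOptRubblingNumber : ∀ {n} → Graph n → ℕ → Set
IsOptRubblingNumber G r =
  (Σ _ λ p → Solvable G p × size p ≡ r) × (∀ p → Solvable G p → r ≤ size p)

-- Project onto a geodesic u = v₀, …, v_d by sending each vertex to its distance from u, capped at d.
-- Pebbling and rubbling moves of G become moves between levels differing by at most one, so a
-- solvable distribution projects to a distribution on the path 0, …, d in which every level is
-- supplied: it holds a pebble, or greedy pebbling towards it from both sides gathers two pebbles
-- next to it. The quantity k + log₂(left pile at k) − bitLength(right pile at k) then grows by at
-- most twice the number of pebbles on each level, which forces d + 2 ≤ 2 |p|.
module Submission where

open import Defs

open import Data.Nat
open import Data.Nat.Properties
open import Data.Nat.Logarithm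
  using (⌊log₂_⌋; ⌊log₂⌋-mono-≤; ⌊log₂⌊n/2⌋⌋≡⌊log₂n⌋∸1; ⌊log₂[2*b]⌋≡1+⌊log₂b⌋)
open import Data.Nat.Tactic.RingSolver using (solve-∀)
open import Algebra.Properties.CommutativeSemigroup +-commutativeSemigroup
  using () renaming (interchange to +-interchange)
open import Data.Fin using (Fin) renaming (zero to fzero; suc to fsuc)
open import Data.Fin.Properties using () renaming (_≟_ to _≟ᶠ_)
open import Data.Product using (_×_; _,_; proj₁; proj₂)
open import Data.Sum using (_⊎_; inj₁; inj₂)
open import Data.Empty using (⊥-elim)
open import Function using (_∘_)
open import Relation.Binary.PropositionalEquality hiding (_≗_)
open import Relation.Binary.Definitions using (tri<; tri≈; tri>)
open import Relation.Binary.Construct.Closure.ReflexiveTransitive using (Star; ε; _◅_)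
open import Relation.Nullary using (¬_; Dec; yes; no)
open import Relation.Nullary.Decidable using (decidable-stable; ¬¬-excluded-middle)
open import Relation.Nullary.Negation using (¬¬-map)

δ : ℕ → ℕ → ℕ
δ x j with x ≟ j
... | yes _ = 1
... | no  _ = 0

δ-diag : ∀ x → δ x x ≡ 1
δ-diag x with x ≟ x
... | yes _   = refl
... | no  x≢x = ⊥-elim (x≢x refl)

δ-≡ : ∀ {x j} → x ≡ j → δ x j ≡ 1
δ-≡ refl = δ-diag _

δ-≢ : ∀ {x j} → x ≢ j → δ x j ≡ 0
δ-≢ {x} {j} x≢j with x ≟ j
... | yes x≡j = ⊥-elim (x≢j x≡j)
... | no  _   = refl

δ-cong : ∀ {x j y k} → (x ≡ j → y ≡ k) → (y ≡ k → x ≡ j) → δ x j ≡ δ y k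
δ-cong {x} {j} f g with x ≟ j
... | yes x≡j = sym (δ-≡ (f x≡j))
... | no  x≢j = sym (δ-≢ (x≢j ∘ g))

infixl 6 _+[_]

_+[_] : (ℕ → ℕ) → ℕ → ℕ → ℕ
(c +[ x ]) j = c j + δ x j

+[]-≢ : ∀ c {x j} → x ≢ j → (c +[ x ]) j ≡ c j
+[]-≢ c {j = j} x≢j = trans (cong (c j +_) (δ-≢ x≢j)) (+-identityʳ (c j))

+[]-diag : ∀ c x → 1 ≤ (c +[ x ]) x
+[]-diag c x = subst (1 ≤_) (cong (c x +_) (sym (δ-diag x))) (m≤n+m 1 (c x))

+[]-≤ : ∀ c x j → c j ≤ (c +[ x ]) j
+[]-≤ c x j = m≤m+n (c j) (δ x j)

total : (ℕ → ℕ) → ℕ → ℕ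
total c zero    = 0
total c (suc k) = total c k + c k

total-cong : ∀ {c c'} k → (∀ j → c j ≡ c' j) → total c k ≡ total c' k
total-cong zero    c≗c' = refl
total-cong (suc k) c≗c' = cong₂ _+_ (total-cong k c≗c') (c≗c' k)

total-+ : ∀ c e k → total (λ j → c j + e j) k ≡ total c k + total e k
total-+ c e zero    = refl
total-+ c e (suc k) = begin
    total (λ j → c j + e j) k + (c k + e k)
  ≡⟨ cong (_+ (c k + e k)) (total-+ c e k) ⟩
    total c k + total e k + (c k + e k)
  ≡⟨ +-interchange (total c k) (total e k) (c k) (e k) ⟩
    total c k + c k + (total e k + e k) ∎
  where open ≡-Reasoning

total-point-≥ : ∀ (f : ℕ → ℕ) x k → k ≤ x → total (λ j → δ x j * f j) k ≡ 0
total-point-≥ f x zero    _   = refl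
total-point-≥ f x (suc k) k<x =
  cong₂ _+_ (total-point-≥ f x k (<⇒≤ k<x)) (cong (_* f k) (δ-≢ (>⇒≢ k<x)))

total-point-< : ∀ (f : ℕ → ℕ) x k → x < k → total (λ j → δ x j * f j) k ≡ f x
total-point-< f x (suc k) x<1+k with m≤n⇒m<n∨m≡n (s≤s⁻¹ x<1+k)
... | inj₁ x<k  = trans (cong₂ _+_ (total-point-< f x k x<k) (cong (_* f k) (δ-≢ (<⇒≢ x<k))))
                        (+-identityʳ (f x))
... | inj₂ refl = trans (cong₂ _+_ (total-point-≥ f x x ≤-refl) (cong (_* f x) (δ-diag x)))
                        (+-identityʳ (f x))

weight : (ℕ → ℕ) → ℕ → ℕ
weight c = total (λ j → c j * 2 ^ j)

weight-+[] : ∀ c x k → weight (c +[ x ]) k ≡ weight c k + weight (δ x) k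
weight-+[] c x k = trans (total-cong k (λ j → *-distribʳ-+ (2 ^ j) (c j) (δ x j)))
                         (total-+ (λ j → c j * 2 ^ j) (λ j → δ x j * 2 ^ j) k)

-- The pile that pebbling moves gather on level k − 1 from the levels below k.
fromLeft : (ℕ → ℕ) → ℕ → ℕ
fromLeft c zero    = 0
fromLeft c (suc k) = c k + ⌊ fromLeft c k /2⌋

fromLeft-cong : ∀ {c c'} k → (∀ j → j < k → c j ≡ c' j) → fromLeft c k ≡ fromLeft c' k
fromLeft-cong zero    c≗c' = refl
fromLeft-cong (suc k) c≗c' =
  cong₂ (λ a b → a + ⌊ b /2⌋) (c≗c' k ≤-refl) (fromLeft-cong k (λ j j<k → c≗c' j (m<n⇒m<1+n j<k)))

fromLeft-mono : ∀ {c c'} k → (∀ j → c j ≤ c' j) → fromLeft c k ≤ fromLeft c' k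
fromLeft-mono zero    c≤c' = z≤n
fromLeft-mono (suc k) c≤c' = +-mono-≤ (c≤c' k) (⌊n/2⌋-mono (fromLeft-mono k c≤c'))

fromLeft-+[] : ∀ c s → fromLeft (c +[ s ]) (suc s) ≡ suc (fromLeft c (suc s))
fromLeft-+[] c s = trans
  (cong₂ (λ a b → c s + a + ⌊ b /2⌋) (δ-diag s) (fromLeft-cong s (λ j j<s → +[]-≢ c (>⇒≢ j<s))))
  (cong (_+ ⌊ fromLeft c s /2⌋) (+-comm (c s) 1))

⌊n/2⌋+⌊n/2⌋≤n : ∀ n → ⌊ n /2⌋ + ⌊ n /2⌋ ≤ n
⌊n/2⌋+⌊n/2⌋≤n n = ≤-trans (+-monoʳ-≤ ⌊ n /2⌋ (⌊n/2⌋≤⌈n/2⌉ n)) (≤-reflexive (⌊n/2⌋+⌈n/2⌉≡n n))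

n≤1+⌊n/2⌋+⌊n/2⌋ : ∀ n → n ≤ suc (⌊ n /2⌋ + ⌊ n /2⌋)
n≤1+⌊n/2⌋+⌊n/2⌋ n = begin
  n                        ≡⟨ sym (⌊n/2⌋+⌈n/2⌉≡n n) ⟩
  ⌊ n /2⌋ + ⌈ n /2⌉        ≤⟨ +-monoʳ-≤ ⌊ n /2⌋ (⌊n/2⌋-mono (n≤1+n (suc n))) ⟩
  ⌊ n /2⌋ + suc ⌊ n /2⌋    ≡⟨ +-suc ⌊ n /2⌋ ⌊ n /2⌋ ⟩
  suc (⌊ n /2⌋ + ⌊ n /2⌋)  ∎
  where open ≤-Reasoning

fromLeft-weight : ∀ c k → fromLeft c k * 2 ^ k ≤ 2 * weight c k
                        × 2 * weight c k < suc (fromLeft c k) * 2 ^ k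
fromLeft-weight c zero    = z≤n , s≤s z≤n
fromLeft-weight c (suc k) = lower , upper
  where
  F = fromLeft c k
  h = ⌊ F /2⌋
  C = c k
  P = 2 ^ k
  W = weight c k
  split : ∀ h C P → (C + h) * (2 * P) ≡ (h + h) * P + 2 * (C * P)
  split = solve-∀
  split-suc : ∀ h C P → suc (C + h) * (2 * P) ≡ suc (suc (h + h)) * P + 2 * (C * P)
  split-suc = solve-∀
  lower : (C + h) * (2 * P) ≤ 2 * (W + C * P)
  lower = begin
      (C + h) * (2 * P)
    ≡⟨ split h C P ⟩
      (h + h) * P + 2 * (C * P)
    ≤⟨ +-monoˡ-≤ _ (≤-trans (*-monoˡ-≤ P (⌊n/2⌋+⌊n/2⌋≤n F)) (proj₁ (fromLeft-weight c k))) ⟩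
      2 * W + 2 * (C * P)
    ≡⟨ sym (*-distribˡ-+ 2 W (C * P)) ⟩
      2 * (W + C * P) ∎
    where open ≤-Reasoning
  upper : 2 * (W + C * P) < suc (C + h) * (2 * P)
  upper = begin-strict
    2 * (W + C * P)                      ≡⟨ *-distribˡ-+ 2 W (C * P) ⟩
    2 * W + 2 * (C * P)                  <⟨ +-monoˡ-< _ (proj₂ (fromLeft-weight c k)) ⟩
    suc F * P + 2 * (C * P)              ≤⟨ +-monoˡ-≤ _ (*-monoˡ-≤ P (s≤s (n≤1+⌊n/2⌋+⌊n/2⌋ F))) ⟩
    suc (suc (h + h)) * P + 2 * (C * P)  ≡⟨ sym (split-suc h C P) ⟩
    suc (C + h) * (2 * P)                ∎
    where open ≤-Reasoning

fromLeft-mono-weight : ∀ c c' k → weight c k ≤ weight c' k → fromLeft c k ≤ fromLeft c' k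
fromLeft-mono-weight c c' k w≤w' = s≤s⁻¹ (*-cancelʳ-< (2 ^ k) (fromLeft c k) (suc (fromLeft c' k))
  (≤-<-trans (proj₁ (fromLeft-weight c k))
    (≤-<-trans (*-monoʳ-≤ 2 w≤w') (proj₂ (fromLeft-weight c' k)))))

Near : ℕ → ℕ → Set
Near a b = a ≤ suc b × b ≤ suc a

Near-sym : ∀ {a b} → Near a b → Near b a
Near-sym (a≤1+b , b≤1+a) = b≤1+a , a≤1+b

Near-≢ : ∀ {a b} → Near a b → a ≢ b → b ≡ suc a ⊎ a ≡ suc b
Near-≢ {a} {b} (a≤1+b , b≤1+a) a≢b with <-cmp a b
... | tri< a<b _   _   = inj₁ (≤-antisym b≤1+a a<b)
... | tri≈ _   a≡b _   = ⊥-elim (a≢b a≡b)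
... | tri> _   _   b<a = inj₂ (≤-antisym a≤1+b b<a)

∸-near : ∀ d {x y} → x ≤ suc y → d ∸ y ≤ suc (d ∸ x)
∸-near d       {zero}        {y}     _              = ≤-trans (m∸n≤m d y) (n≤1+n d)
∸-near zero    {suc x}       {y}     _              = ≤-trans (m∸n≤m 0 y) z≤n
∸-near (suc d) {suc zero}    {zero}  _              = ≤-refl
∸-near (suc d) {suc (suc x)} {zero}  (s≤s ())
∸-near (suc d) {suc x}       {suc y} (s≤s x≤1+y)    = ∸-near d x≤1+y

Near-∸ : ∀ d {a b} → Near a b → Near (d ∸ a) (d ∸ b)
Near-∸ d (a≤1+b , b≤1+a) = ∸-near d b≤1+a , ∸-near d a≤1+b

^-near : ∀ a b b' → a ≤ suc b → a ≤ suc b' → 2 ^ a ≤ 2 ^ b + 2 ^ b'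
^-near zero    b b' _ _ = ≤-trans (m^n>0 2 b) (m≤m+n (2 ^ b) (2 ^ b'))
^-near (suc a) b b' (s≤s a≤b) (s≤s a≤b') =
  subst (_≤ 2 ^ b + 2 ^ b') (cong (2 ^ a +_) (sym (+-identityʳ (2 ^ a))))
        (+-mono-≤ (^-monoʳ-≤ 2 a≤b) (^-monoʳ-≤ 2 a≤b'))

weight-move : ∀ R {a b b'} i → Near a b → Near a b' → i ≢ b → i ≢ b' →
              weight (R +[ a ]) i ≤ weight (R +[ b' ] +[ b ]) i
weight-move R {a} {b} {b'} i (a≤1+b , b≤1+a) (a≤1+b' , b'≤1+a) i≢b i≢b' = begin
      weight (R +[ a ]) i
    ≡⟨ weight-+[] R a i ⟩
      weight R i + weight (δ a) i
    ≤⟨ +-monoʳ-≤ (weight R i) moved ⟩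
      weight R i + (weight (δ b') i + weight (δ b) i)
    ≡⟨ sym (+-assoc (weight R i) _ _) ⟩
      weight R i + weight (δ b') i + weight (δ b) i
    ≡⟨ cong (_+ weight (δ b) i) (sym (weight-+[] R b' i)) ⟩
      weight (R +[ b' ]) i + weight (δ b) i
    ≡⟨ sym (weight-+[] (R +[ b' ]) b i) ⟩
      weight (R +[ b' ] +[ b ]) i ∎
  where
  open ≤-Reasoning
  below : ∀ {y} → y ≤ suc a → i ≢ y → a < i → y < i
  below y≤1+a i≢y a<i = ≤∧≢⇒< (≤-trans y≤1+a a<i) (i≢y ∘ sym)
  moved : weight (δ a) i ≤ weight (δ b') i + weight (δ b) i
  moved with a <? i
  ... | no  a≮i = ≤-trans (≤-reflexive (total-point-≥ (2 ^_) a i (≮⇒≥ a≮i))) z≤n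
  ... | yes a<i = begin
      weight (δ a) i
    ≡⟨ total-point-< (2 ^_) a i a<i ⟩
      2 ^ a
    ≤⟨ ^-near a b' b a≤1+b' a≤1+b ⟩
      2 ^ b' + 2 ^ b
    ≡⟨ sym (cong₂ _+_ (total-point-< (2 ^_) b' i (below b'≤1+a i≢b' a<i))
                      (total-point-< (2 ^_) b i (below b≤1+a i≢b a<i))) ⟩
      weight (δ b') i + weight (δ b) i ∎

fromLeft-move : ∀ R {a b b'} i → Near a b → Near a b' → i ≢ b → i ≢ b' →
                fromLeft (R +[ a ]) i ≤ fromLeft (R +[ b' ] +[ b ]) i
fromLeft-move R i a~b a~b' i≢b i≢b' =
  fromLeft-mono-weight _ _ i (weight-move R i a~b a~b' i≢b i≢b')

bitLength : ℕ → ℕ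
bitLength zero    = 0
bitLength (suc n) = suc ⌊log₂ suc n ⌋

⌊log₂⌋-half : ∀ n → ⌊log₂ (2 + n) ⌋ ≡ suc ⌊log₂ ⌊ 2 + n /2⌋ ⌋
⌊log₂⌋-half n = begin
  ⌊log₂ (2 + n) ⌋              ≡⟨ sym (m+[n∸m]≡n (⌊log₂⌋-mono-≤ {2} {2 + n} (s≤s (s≤s z≤n)))) ⟩
  suc (⌊log₂ (2 + n) ⌋ ∸ 1)    ≡⟨ cong suc (sym (⌊log₂⌊n/2⌋⌋≡⌊log₂n⌋∸1 (2 + n))) ⟩
  suc ⌊log₂ ⌊ 2 + n /2⌋ ⌋      ∎
  where open ≡-Reasoning

bitLength-half : ∀ n → bitLength (suc n) ≡ suc (bitLength ⌊ suc n /2⌋)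
bitLength-half zero    = refl
bitLength-half (suc n) = cong suc (⌊log₂⌋-half n)

bitLength⌊n/2⌋≤⌊log₂n⌋ : ∀ n → bitLength ⌊ n /2⌋ ≤ ⌊log₂ n ⌋
bitLength⌊n/2⌋≤⌊log₂n⌋ zero    = z≤n
bitLength⌊n/2⌋≤⌊log₂n⌋ (suc n) = ≤-reflexive (sym (suc-injective (bitLength-half n)))

bitLength-mono : ∀ {m n} → m ≤ n → bitLength m ≤ bitLength n
bitLength-mono z≤n       = z≤n
bitLength-mono (s≤s m≤n) = s≤s (⌊log₂⌋-mono-≤ (s≤s m≤n))

bitLength-suc : ∀ n → bitLength (suc n) ≤ suc (bitLength n)
bitLength-suc zero    = ≤-refl
bitLength-suc (suc n) =
  s≤s (≤-trans (⌊log₂⌋-mono-≤ 2+n≤2*[1+n]) (≤-reflexive (⌊log₂[2*b]⌋≡1+⌊log₂b⌋ (suc n))))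
  where
  2+n≤2*[1+n] : 2 + n ≤ 2 * suc n
  2+n≤2*[1+n] = ≤-trans (+-monoʳ-≤ 2 (m≤m+n n (n + 0))) (≤-reflexive (sym (*-suc 2 n)))

bitLength-+ : ∀ c y → bitLength (c + y) ≤ c + bitLength y
bitLength-+ zero    y = ≤-refl
bitLength-+ (suc c) y = ≤-trans (bitLength-suc (c + y)) (s≤s (bitLength-+ c y))

-- F and G are the piles flanking a supplied level holding C pebbles.
halving-step : ∀ C F G → 2 ≤ 2 * C + F + G →
               suc (suc ⌊log₂ (C + ⌊ F /2⌋) ⌋ + bitLength (C + ⌊ G /2⌋))
                 ≤ 2 * C + suc ⌊log₂ F ⌋ + bitLength G
halving-step zero F (suc G) _ = begin
    suc (suc ⌊log₂ ⌊ F /2⌋ ⌋ + bitLength ⌊ suc G /2⌋)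
  ≡⟨ sym (+-suc (suc ⌊log₂ ⌊ F /2⌋ ⌋) _) ⟩
    suc ⌊log₂ ⌊ F /2⌋ ⌋ + suc (bitLength ⌊ suc G /2⌋)
  ≤⟨ +-mono-≤ (s≤s (⌊log₂⌋-mono-≤ (⌊n/2⌋≤n F))) (≤-reflexive (sym (bitLength-half G))) ⟩
    suc ⌊log₂ F ⌋ + bitLength (suc G) ∎
  where open ≤-Reasoning
halving-step zero (suc (suc F)) zero _ = ≤-reflexive (begin
  suc (suc ⌊log₂ ⌊ 2 + F /2⌋ ⌋ + 0)  ≡⟨ cong suc (+-identityʳ _) ⟩
  suc (suc ⌊log₂ ⌊ 2 + F /2⌋ ⌋)      ≡⟨ cong suc (sym (⌊log₂⌋-half F)) ⟩
  suc ⌊log₂ (2 + F) ⌋                ≡⟨ sym (+-identityʳ _) ⟩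
  suc ⌊log₂ (2 + F) ⌋ + 0            ∎)
  where open ≡-Reasoning
halving-step zero (suc zero) zero (s≤s ())
halving-step zero zero       zero ()
halving-step C@(suc _) F G _ = begin
    suc (suc ⌊log₂ (C + ⌊ F /2⌋) ⌋ + bitLength (C + ⌊ G /2⌋))
  ≤⟨ +-mono-≤ left right ⟩
    C + suc ⌊log₂ F ⌋ + (C + bitLength G)
  ≡⟨ shuffle C (suc ⌊log₂ F ⌋) (bitLength G) ⟩
    2 * C + suc ⌊log₂ F ⌋ + bitLength G ∎
  where
  open ≤-Reasoning
  shuffle : ∀ C a b → C + a + (C + b) ≡ 2 * C + a + b
  shuffle = solve-∀
  left : suc (bitLength (C + ⌊ F /2⌋)) ≤ C + suc ⌊log₂ F ⌋
  left = ≤-trans (s≤s (bitLength-+ C ⌊ F /2⌋))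
                 (≤-trans (≤-reflexive (sym (+-suc C _))) (+-monoʳ-≤ C (s≤s (bitLength⌊n/2⌋≤⌊log₂n⌋ F))))
  right : bitLength (C + ⌊ G /2⌋) ≤ C + bitLength G
  right = ≤-trans (bitLength-+ C ⌊ G /2⌋) (+-monoʳ-≤ C (bitLength-mono (⌊n/2⌋≤n G)))

module Path (d : ℕ) where

  reverse : (ℕ → ℕ) → ℕ → ℕ
  reverse c j = c (d ∸ j)

  -- The pile that pebbling moves gather on level k from the levels k, …, d.
  fromRight : (ℕ → ℕ) → ℕ → ℕ
  fromRight c k = fromLeft (reverse c) (suc d ∸ k)

  reverse-+[] : ∀ c {x j} → x ≤ d → j ≤ d → reverse (c +[ x ]) j ≡ (reverse c +[ d ∸ x ]) j
  reverse-+[] c {x} {j} x≤d j≤d = cong (c (d ∸ j) +_) (δ-cong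
    (λ x≡d∸j → trans (cong (d ∸_) x≡d∸j) (m∸[m∸n]≡n j≤d))
    (λ d∸x≡j → trans (sym (m∸[m∸n]≡n x≤d)) (cong (d ∸_) d∸x≡j)))

  fromRight-step : ∀ c k → k ≤ d → fromRight c k ≡ c k + ⌊ fromRight c (suc k) /2⌋
  fromRight-step c k k≤d = trans (cong (fromLeft (reverse c)) (+-∸-assoc 1 k≤d))
                                 (cong (λ j → c j + ⌊ fromRight c (suc k) /2⌋) (m∸[m∸n]≡n k≤d))

  fromRight-end : ∀ c → fromRight c (suc d) ≡ 0
  fromRight-end c = cong (fromLeft (reverse c)) (n∸n≡0 d)

  fromRight-mono : ∀ {c c'} k → (∀ j → c j ≤ c' j) → fromRight c k ≤ fromRight c' k
  fromRight-mono k c≤c' = fromLeft-mono (suc d ∸ k) (λ j → c≤c' (d ∸ j))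

  below-∸ : ∀ i {j} → j < d ∸ i → j ≤ d
  below-∸ i j<d∸i = ≤-trans (<⇒≤ j<d∸i) (m∸n≤m d i)

  fromRight-+[] : ∀ c i → suc i ≤ d → fromRight (c +[ suc i ]) (suc i) ≡ suc (fromRight c (suc i))
  fromRight-+[] c i i<d = begin
      fromLeft (reverse (c +[ suc i ])) (d ∸ i)
    ≡⟨ fromLeft-cong (d ∸ i) (λ j j<d∸i → reverse-+[] c i<d (below-∸ i j<d∸i)) ⟩
      fromLeft (reverse c +[ d ∸ suc i ]) (d ∸ i)
    ≡⟨ cong (fromLeft (reverse c +[ d ∸ suc i ])) d∸i≡1+d∸[1+i] ⟩
      fromLeft (reverse c +[ d ∸ suc i ]) (suc (d ∸ suc i))
    ≡⟨ fromLeft-+[] (reverse c) (d ∸ suc i) ⟩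
      suc (fromLeft (reverse c) (suc (d ∸ suc i)))
    ≡⟨ cong (suc ∘ fromLeft (reverse c)) (sym d∸i≡1+d∸[1+i]) ⟩
      suc (fromLeft (reverse c) (d ∸ i)) ∎
    where
    open ≡-Reasoning
    d∸i≡1+d∸[1+i] : d ∸ i ≡ suc (d ∸ suc i)
    d∸i≡1+d∸[1+i] = +-∸-assoc 1 i<d

  fromRight-move : ∀ R {a b b' i} → a ≤ d → b ≤ d → b' ≤ d → i ≤ d → Near a b → Near a b' →
                   i ≢ b → i ≢ b' → fromRight (R +[ a ]) (suc i) ≤ fromRight (R +[ b' ] +[ b ]) (suc i)
  fromRight-move R {a} {b} {b'} {i} a≤d b≤d b'≤d i≤d a~b a~b' i≢b i≢b' = begin
      fromLeft (reverse (R +[ a ])) (d ∸ i)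
    ≡⟨ fromLeft-cong (d ∸ i) (λ j j<d∸i → reverse-+[] R a≤d (below-∸ i j<d∸i)) ⟩
      fromLeft (reverse R +[ d ∸ a ]) (d ∸ i)
    ≤⟨ fromLeft-move (reverse R) (d ∸ i) (Near-∸ d a~b) (Near-∸ d a~b') (flip b≤d i≢b) (flip b'≤d i≢b') ⟩
      fromLeft (reverse R +[ d ∸ b' ] +[ d ∸ b ]) (d ∸ i)
    ≡⟨ fromLeft-cong (d ∸ i) (λ j j<d∸i → sym (reverse-+[]² (below-∸ i j<d∸i))) ⟩
      fromLeft (reverse (R +[ b' ] +[ b ])) (d ∸ i) ∎
    where
    open ≤-Reasoning
    reverse-+[]² : ∀ {j} → j ≤ d → reverse (R +[ b' ] +[ b ]) j ≡ (reverse R +[ d ∸ b' ] +[ d ∸ b ]) j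
    reverse-+[]² {j} j≤d =
      trans (reverse-+[] (R +[ b' ]) b≤d j≤d) (cong (_+ δ (d ∸ b) j) (reverse-+[] R b'≤d j≤d))
    flip : ∀ {y} → y ≤ d → i ≢ y → d ∸ i ≢ d ∸ y
    flip y≤d i≢y d∸i≡d∸y = i≢y (∸-cancelˡ-≡ i≤d y≤d d∸i≡d∸y)

  -- A pebble can reach level i only if i holds a pebble, or two pebbles can be gathered on one
  -- neighbour of i, or one on each neighbour.
  Supplied : (ℕ → ℕ) → ℕ → Set
  Supplied c i = 2 ≤ 2 * c i + fromLeft c i + fromRight c (suc i)

  Supplied-cong : ∀ {c c'} i → (∀ j → c j ≡ c' j) → Supplied c i → Supplied c' i
  Supplied-cong i c≗c' = subst (2 ≤_) (cong₂ _+_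
    (cong₂ _+_ (cong (2 *_) (c≗c' i)) (fromLeft-cong i (λ j _ → c≗c' j)))
    (fromLeft-cong (d ∸ i) (λ j _ → c≗c' (d ∸ j))))

  occupied⇒Supplied : ∀ c i → 1 ≤ c i → Supplied c i
  occupied⇒Supplied c i 1≤ci = ≤-trans (*-monoʳ-≤ 2 1≤ci) (≤-trans (m≤m+n _ _) (m≤m+n _ _))

  flank : (ℕ → ℕ) → ℕ → ℕ
  flank c i = fromLeft c i + fromRight c (suc i)

  flank⇒Supplied : ∀ c i → 2 ≤ flank c i → Supplied c i
  flank⇒Supplied c i 2≤flank = ≤-trans 2≤flank
    (≤-trans (m≤n+m _ (2 * c i)) (≤-reflexive (sym (+-assoc (2 * c i) _ _))))

  flank-+[] : ∀ Z {s i} → s ≤ d → Near s i → s ≢ i → suc (flank Z i) ≤ flank (Z +[ s ]) i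
  flank-+[] Z {s} {i} s≤d s~i s≢i with Near-≢ s~i s≢i
  ... | inj₁ refl = subst (λ l → suc (flank Z (suc s)) ≤ l + fromRight (Z +[ s ]) (suc (suc s)))
                          (sym (fromLeft-+[] Z s))
                          (s≤s (+-monoʳ-≤ _ (fromRight-mono (suc (suc s)) (+[]-≤ Z s))))
  ... | inj₂ refl = subst (λ r → suc (flank Z i) ≤ fromLeft (Z +[ suc i ]) i + r)
                          (sym (fromRight-+[] Z i s≤d))
                          (≤-trans (≤-reflexive (sym (+-suc _ _)))
                                   (+-monoˡ-≤ _ (fromLeft-mono i (+[]-≤ Z (suc i)))))

  Supplied-transfer : ∀ R {a b b' i} → a ≤ d → b ≤ d → b' ≤ d → i ≤ d → Near a b → Near a b' →
                  Supplied (R +[ a ]) i → Supplied (R +[ b' ] +[ b ]) i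
  Supplied-transfer R {a} {b} {b'} {i} a≤d b≤d b'≤d i≤d a~b a~b' supplied
    with i ≟ b | i ≟ b' | i ≟ a
  ... | yes refl | _        | _        = occupied⇒Supplied _ i (+[]-diag (R +[ b' ]) i)
  ... | no  _    | yes refl | _        =
    occupied⇒Supplied _ i (≤-trans (+[]-diag R i) (+[]-≤ (R +[ i ]) b i))
  ... | no  i≢b  | no  i≢b' | yes refl = flank⇒Supplied _ i (begin
      2                                ≤⟨ s≤s (s≤s z≤n) ⟩
      suc (suc (flank R i))            ≤⟨ s≤s (flank-+[] R b'≤d (Near-sym a~b') (i≢b' ∘ sym)) ⟩
      suc (flank (R +[ b' ]) i)        ≤⟨ flank-+[] (R +[ b' ]) b≤d (Near-sym a~b) (i≢b ∘ sym) ⟩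
      flank (R +[ b' ] +[ b ]) i       ∎)
    where open ≤-Reasoning
  ... | no  i≢b  | no  i≢b' | no  i≢a  = ≤-trans supplied (+-mono-≤ (+-mono-≤
      (*-monoʳ-≤ 2 unmoved) (fromLeft-move R i a~b a~b' i≢b i≢b'))
      (fromRight-move R a≤d b≤d b'≤d i≤d a~b a~b' i≢b i≢b'))
    where
    unmoved : (R +[ a ]) i ≤ (R +[ b' ] +[ b ]) i
    unmoved = ≤-trans (≤-reflexive (+[]-≢ R (i≢a ∘ sym))) (≤-trans (+[]-≤ R b' i) (+[]-≤ (R +[ b' ]) b i))

  Potential : (ℕ → ℕ) → ℕ → Set
  Potential c k = k + suc ⌊log₂ fromLeft c k ⌋ ≤ 2 * total c k + bitLength (fromRight c k)

  potential-zero : ∀ c → Supplied c 0 → Potential c 0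
  potential-zero c supplied = subst (λ g → 1 ≤ bitLength g) (sym (fromRight-step c 0 z≤n))
                                    (bitLength-mono (positive (c 0) _ supplied))
    where
    positive : ∀ C G → 2 ≤ 2 * C + 0 + G → 1 ≤ C + ⌊ G /2⌋
    positive zero    G 2≤G = ⌊n/2⌋-mono 2≤G
    positive (suc C) G _   = s≤s z≤n

  potential-suc : ∀ c k → k ≤ d → Supplied c k → Potential c k → Potential c (suc k)
  potential-suc c k k≤d supplied potential =
    +-cancelʳ-≤ (suc ⌊log₂ F ⌋ + bitLength (C + ⌊ G /2⌋)) _ _ (begin
      suc k + suc ⌊log₂ (C + ⌊ F /2⌋) ⌋ + (suc ⌊log₂ F ⌋ + bitLength (C + ⌊ G /2⌋))
        ≡⟨ regroup₁ k (suc ⌊log₂ (C + ⌊ F /2⌋) ⌋) (suc ⌊log₂ F ⌋) (bitLength (C + ⌊ G /2⌋)) ⟩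
      (k + suc ⌊log₂ F ⌋) + suc (suc ⌊log₂ (C + ⌊ F /2⌋) ⌋ + bitLength (C + ⌊ G /2⌋))
        ≤⟨ +-mono-≤ (subst (λ r → k + suc ⌊log₂ F ⌋ ≤ 2 * T + bitLength r)
                           (fromRight-step c k k≤d) potential)
                    (halving-step C F G supplied) ⟩
      (2 * T + bitLength (C + ⌊ G /2⌋)) + (2 * C + suc ⌊log₂ F ⌋ + bitLength G)
        ≡⟨ regroup₂ T C (bitLength (C + ⌊ G /2⌋)) (suc ⌊log₂ F ⌋) (bitLength G) ⟩
      2 * (T + C) + bitLength G + (suc ⌊log₂ F ⌋ + bitLength (C + ⌊ G /2⌋)) ∎)
    where
    open ≤-Reasoning
    C = c k
    F = fromLeft c k
    G = fromRight c (suc k)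
    T = total c k
    regroup₁ : ∀ k z x y → suc k + z + (x + y) ≡ k + x + suc (z + y)
    regroup₁ = solve-∀
    regroup₂ : ∀ T C y x g → 2 * T + y + (2 * C + x + g) ≡ 2 * (T + C) + g + (x + y)
    regroup₂ = solve-∀

  potential : ∀ c → (∀ i → i ≤ d → Supplied c i) → ∀ k → k ≤ suc d → Potential c k
  potential c supplied zero    _         = potential-zero c (supplied 0 z≤n)
  potential c supplied (suc k) (s≤s k≤d) =
    potential-suc c k k≤d (supplied k k≤d) (potential c supplied k (m≤n⇒m≤1+n k≤d))

  Supplied⇒2+d≤2*total : ∀ c → (∀ i → i ≤ d → Supplied c i) → 2 + d ≤ 2 * total c (suc d)
  Supplied⇒2+d≤2*total c supplied = begin
      2 + d
    ≡⟨ cong suc (+-comm 1 d) ⟩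
      suc d + 1
    ≤⟨ +-monoʳ-≤ (suc d) (s≤s z≤n) ⟩
      suc d + suc ⌊log₂ fromLeft c (suc d) ⌋
    ≤⟨ potential c supplied (suc d) ≤-refl ⟩
      2 * total c (suc d) + bitLength (fromRight c (suc d))
    ≡⟨ cong (λ g → 2 * total c (suc d) + bitLength g) (fromRight-end c) ⟩
      2 * total c (suc d) + 0
    ≡⟨ +-identityʳ _ ⟩
      2 * total c (suc d) ∎
    where open ≤-Reasoning

size-cong : ∀ {n} {f g : Fin n → ℕ} → (∀ x → f x ≡ g x) → size f ≡ size g
size-cong {zero}  f≗g = refl
size-cong {suc n} f≗g = cong₂ _+_ (f≗g fzero) (size-cong (f≗g ∘ fsuc))

size-zero : ∀ n → size {n} (λ _ → 0) ≡ 0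
size-zero zero    = refl
size-zero (suc n) = size-zero n

size-+ : ∀ {n} (f g : Fin n → ℕ) → size (λ x → f x + g x) ≡ size f + size g
size-+ {zero}  f g = refl
size-+ {suc n} f g = trans (cong (f fzero + g fzero +_) (size-+ (f ∘ fsuc) (g ∘ fsuc)))
                           (+-interchange (f fzero) (g fzero) (size (f ∘ fsuc)) (size (g ∘ fsuc)))

≤-size : ∀ {n} (f : Fin n → ℕ) x → f x ≤ size f
≤-size f fzero    = m≤m+n (f fzero) _
≤-size f (fsuc x) = ≤-trans (≤-size (f ∘ fsuc) x) (m≤n+m _ (f fzero))

total-size : ∀ {n} (g : Fin n → ℕ → ℕ) K → total (λ j → size (λ x → g x j)) K ≡ size (λ x → total (g x) K)
total-size {n} g zero    = sym (size-zero n)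
total-size     g (suc K) = trans (cong (_+ size (λ x → g x K)) (total-size g K))
                                 (sym (size-+ (λ x → total (g x) K) (λ x → g x K)))

add1-fsuc : ∀ {n} (u x : Fin n) p → add1 (fsuc u) p (fsuc x) ≡ add1 u (p ∘ fsuc) x
add1-fsuc u x p with x ≟ᶠ u
... | yes _ = refl
... | no  _ = refl

size-*add1 : ∀ {n} (w : Fin n → ℕ) u p → size (λ x → w x * add1 u p x) ≡ size (λ x → w x * p x) + w u
size-*add1 {suc n} w fzero    p = begin
    w fzero * suc (p fzero) + S  ≡⟨ cong (_+ S) (*-suc (w fzero) (p fzero)) ⟩
    w fzero + w fzero * p fzero + S  ≡⟨ rotate (w fzero) (w fzero * p fzero) S ⟩
    w fzero * p fzero + S + w fzero ∎
  where
  open ≡-Reasoning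
  S = size (λ x → w (fsuc x) * p (fsuc x))
  rotate : ∀ a b s → a + b + s ≡ b + s + a
  rotate = solve-∀
size-*add1 {suc n} w (fsuc u) p = begin
    w fzero * p fzero + size (λ x → w (fsuc x) * add1 (fsuc u) p (fsuc x))
  ≡⟨ cong (w fzero * p fzero +_) (size-cong (λ x → cong (w (fsuc x) *_) (add1-fsuc u x p))) ⟩
    w fzero * p fzero + size (λ x → w (fsuc x) * add1 u (p ∘ fsuc) x)
  ≡⟨ cong (w fzero * p fzero +_) (size-*add1 (w ∘ fsuc) u (p ∘ fsuc)) ⟩
    w fzero * p fzero + (size (λ x → w (fsuc x) * p (fsuc x)) + w (fsuc u))
  ≡⟨ sym (+-assoc (w fzero * p fzero) _ _) ⟩
    w fzero * p fzero + size (λ x → w (fsuc x) * p (fsuc x)) + w (fsuc u) ∎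
  where open ≡-Reasoning

module Projection {m : ℕ} (level : Fin m → ℕ) where

  project : Distribution m → ℕ → ℕ
  project p j = size (λ x → δ (level x) j * p x)

  project-cong : ∀ {p q} → p ≗ q → ∀ j → project p j ≡ project q j
  project-cong p≗q j = size-cong (λ x → cong (δ (level x) j *_) (p≗q x))

  project-add1 : ∀ v r j → project (add1 v r) j ≡ (project r +[ level v ]) j
  project-add1 v r j = size-*add1 (λ x → δ (level x) j) v r

  project-add1² : ∀ v w r j → project (add1 v (add1 w r)) j ≡ (project r +[ level w ] +[ level v ]) j
  project-add1² v w r j = trans (project-add1 v (add1 w r) j) (cong (_+ δ (level v) j) (project-add1 w r j))

  ≤-project : ∀ p t → p t ≤ project p (level t)
  ≤-project p t = ≤-trans (≤-reflexive (sym (trans (cong (_* p t) (δ-diag (level t))) (+-identityʳ (p t)))))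
                          (≤-size (λ x → δ (level x) (level t) * p x) t)

  total-project : ∀ p K → (∀ x → level x < K) → total (project p) K ≡ size p
  total-project p K level<K = trans (total-size (λ x j → δ (level x) j * p x) K)
                                    (size-cong (λ x → total-point-< (λ _ → p x) (level x) K (level<K x)))

module Walks {m : ℕ} (G : Graph m) where

  snoc : ∀ {a x y k} → Walk G a x k → Adj G x y → Walk G a y (suc k)
  snoc nil        x~y = cons x~y nil
  snoc (cons e w) x~y = cons e (snoc w x~y)

  _++ʷ_ : ∀ {a b c k l} → Walk G a b k → Walk G b c l → Walk G a c (k + l)
  nil      ++ʷ w' = w'
  cons e w ++ʷ w' = cons e (w ++ʷ w')

  vertexAt : ∀ {a b k} → Walk G a b k → ℕ → Fin m
  vertexAt {a} nil        _       = a
  vertexAt {a} (cons _ _) zero    = a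
  vertexAt     (cons _ w) (suc i) = vertexAt w i

  take : ∀ {a b k} (w : Walk G a b k) i → i ≤ k → Walk G a (vertexAt w i) i
  take nil        zero    _         = nil
  take (cons _ _) zero    _         = nil
  take (cons e w) (suc i) (s≤s i≤k) = cons e (take w i i≤k)

  drop : ∀ {a b k} (w : Walk G a b k) i → i ≤ k → Walk G (vertexAt w i) b (k ∸ i)
  drop nil        zero    _         = nil
  drop (cons e w) zero    _         = cons e w
  drop (cons _ w) (suc i) (s≤s i≤k) = drop w i i≤k

firstHit : ∀ k {P : ℕ → Set} → (∀ j → j < k → Dec (P j)) → ℕ
firstHit zero    P? = 0
firstHit (suc k) P? with P? 0 z<s
... | yes _ = 0
... | no  _ = suc (firstHit k (λ j j<k → P? (suc j) (s<s j<k)))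

firstHit-≤ : ∀ k {P : ℕ → Set} (P? : ∀ j → j < k → Dec (P j)) → firstHit k P? ≤ k
firstHit-≤ zero    P? = z≤n
firstHit-≤ (suc k) P? with P? 0 z<s
... | yes _ = z≤n
... | no  _ = s≤s (firstHit-≤ k _)

firstHit-minimal : ∀ k {P : ℕ → Set} (P? : ∀ j → j < k → Dec (P j)) j → j < k → P j → firstHit k P? ≤ j
firstHit-minimal (suc k) P? j j<k Pj with P? 0 z<s
firstHit-minimal (suc k) P? j       j<k   Pj | yes _  = z≤n
firstHit-minimal (suc k) P? zero    _     P0 | no ¬P0 = ⊥-elim (¬P0 P0)
firstHit-minimal (suc k) P? (suc j) j<1+k Pj | no _   = s≤s (firstHit-minimal k _ j (s<s⁻¹ j<1+k) Pj)

firstHit-hit : ∀ k {P : ℕ → Set} (P? : ∀ j → j < k → Dec (P j)) → firstHit k P? < k → P (firstHit k P?)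
firstHit-hit (suc k) P? hit<k with P? 0 z<s
... | yes P0 = P0
... | no  _  = firstHit-hit k _ (s<s⁻¹ hit<k)

module Levels {m : ℕ} (G : Graph m) (u : Fin m) (d : ℕ)
              (walk? : ∀ x j → j < d → Dec (Walk G u x j)) where
  open Walks G

  level : Fin m → ℕ
  level x = firstHit d (walk? x)

  level-≤ : ∀ x → level x ≤ d
  level-≤ x = firstHit-≤ d (walk? x)

  level-edge : ∀ {x y} → Adj G x y → level y ≤ suc (level x)
  level-edge {x} {y} x~y with level x <? d
  ... | no  x≮d = ≤-trans (level-≤ y) (≤-trans (≮⇒≥ x≮d) (n≤1+n _))
  ... | yes x<d with suc (level x) <? d
  ...   | yes 1+x<d = firstHit-minimal d (walk? y) _ 1+x<d (snoc (firstHit-hit d (walk? x) x<d) x~y)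
  ...   | no  1+x≮d = ≤-trans (level-≤ y) (≮⇒≥ 1+x≮d)

  level-geodesic : ∀ {v} (w : Walk G u v d) → (∀ j → j < d → ¬ Walk G u v j) →
                   ∀ i → i ≤ d → level (vertexAt w i) ≡ i
  level-geodesic w shortest i i≤d = ≤-antisym level≤i (≮⇒≥ i≮level)
    where
    t = vertexAt w i
    level≤i : level t ≤ i
    level≤i with i <? d
    ... | yes i<d = firstHit-minimal d (walk? t) i i<d (take w i i≤d)
    ... | no  i≮d = ≤-trans (level-≤ t) (≮⇒≥ i≮d)
    i≮level : ¬ level t < i
    i≮level level<i = shortest (level t + (d ∸ i)) shorter
      (firstHit-hit d (walk? t) (<-≤-trans level<i i≤d) ++ʷ drop w i i≤d)
      where
      shorter : level t + (d ∸ i) < d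
      shorter = subst (level t + (d ∸ i) <_) (m+[n∸m]≡n i≤d) (+-monoˡ-< (d ∸ i) level<i)

module LevelMoves {m : ℕ} (G : Graph m) (d : ℕ) (level : Fin m → ℕ) (level-≤ : ∀ x → level x ≤ d)
                  (level-edge : ∀ {x y} → Adj G x y → level y ≤ suc (level x)) where
  open Projection level
  open Path d

  near : ∀ {x y} → Adj G x y → Near (level y) (level x)
  near x~y = level-edge x~y , level-edge (symmetric G x~y)

  Supplied-Move : ∀ {p q} i → i ≤ d → Move G p q → Supplied (project q) i → Supplied (project p) i
  Supplied-Move i i≤d (pebbling {u} {v} r v~u) supplied =
    Supplied-cong i (sym ∘ project-add1² v v r)
      (Supplied-transfer (project r) (level-≤ u) (level-≤ v) (level-≤ v) i≤d (near v~u) (near v~u)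
        (Supplied-cong i (project-add1 u r) supplied))
  Supplied-Move i i≤d (rubbling {u} {v} {w} r _ v~u w~u) supplied =
    Supplied-cong i (sym ∘ project-add1² v w r)
      (Supplied-transfer (project r) (level-≤ u) (level-≤ v) (level-≤ w) i≤d (near v~u) (near w~u)
        (Supplied-cong i (project-add1 u r) supplied))

  Supplied-Star : ∀ {p q} i → i ≤ d → Star (Step G) p q → Supplied (project q) i → Supplied (project p) i
  Supplied-Star i i≤d ε                                supplied = supplied
  Supplied-Star i i≤d ((p' , q' , p≗p' , move , q'≗q) ◅ steps) supplied =
    Supplied-cong i (sym ∘ project-cong p≗p')
      (Supplied-Move i i≤d move
        (Supplied-cong i (sym ∘ project-cong q'≗q) (Supplied-Star i i≤d steps supplied)))

  Reachable⇒Supplied : ∀ {p} t → Reachable G p t → Supplied (project p) (level t)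
  Reachable⇒Supplied t (q , steps , 1≤qt) =
    Supplied-Star (level t) (level-≤ t) steps
      (occupied⇒Supplied (project q) (level t) (≤-trans 1≤qt (≤-project q t)))

¬¬-∀-< : ∀ k {P : ℕ → Set} → (∀ j → j < k → ¬ ¬ P j) → ¬ ¬ (∀ j → j < k → P j)
¬¬-∀-< zero    _      ¬all = ¬all (λ _ ())
¬¬-∀-< (suc k) {P} ¬¬P ¬all =
  ¬¬-∀-< k (λ j j<k → ¬¬P j (m<n⇒m<1+n j<k))
           (λ below → ¬¬P k ≤-refl (λ Pk → ¬all (extend below Pk)))
  where
  extend : (∀ j → j < k → P j) → P k → ∀ j → j < suc k → P j
  extend below Pk j j<1+k with m≤n⇒m<n∨m≡n (s≤s⁻¹ j<1+k)
  ... | inj₁ j<k  = below j j<k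
  ... | inj₂ refl = Pk

¬¬-∀-Fin : ∀ k {P : Fin k → Set} → (∀ i → ¬ ¬ P i) → ¬ ¬ (∀ i → P i)
¬¬-∀-Fin zero    _ ¬all = ¬all (λ ())
¬¬-∀-Fin (suc k) {P} ¬¬P ¬all =
  ¬¬-∀-Fin k (¬¬P ∘ fsuc) (λ rest → ¬¬P fzero (λ P0 → ¬all (extend P0 rest)))
  where
  extend : P fzero → (∀ i → P (fsuc i)) → ∀ i → P i
  extend P0 _    fzero    = P0
  extend _  rest (fsuc i) = rest i

-- Walks need not be decidable, but the conclusion is, so deciding them is harmless under ¬ ¬.
geodesic⇒2+d≤2*size : ∀ {m} (G : Graph m) {u v d} (w : Walk G u v d) →
                      (∀ j → j < d → ¬ Walk G u v j) → ∀ p → Solvable G p → 2 + d ≤ 2 * size p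
geodesic⇒2+d≤2*size {m} G {u} {v} {d} w shortest p solvable =
  decidable-stable (2 + d ≤? 2 * size p)
    (¬¬-map bound (¬¬-∀-Fin m (λ x → ¬¬-∀-< d (λ j _ → ¬¬-excluded-middle))))
  where
  bound : (∀ x j → j < d → Dec (Walk G u x j)) → 2 + d ≤ 2 * size p
  bound walk? = subst (λ s → 2 + d ≤ 2 * s) (total-project p (suc d) (λ x → s≤s (level-≤ x)))
    (Supplied⇒2+d≤2*total (project p) λ i i≤d →
      subst (Supplied (project p)) (level-geodesic w shortest i i≤d)
            (Reachable⇒Supplied (vertexAt w i) (solvable (vertexAt w i))))
    where
    open Walks G
    open Levels G u d walk?
    open Projection level
    open Path d
    open LevelMoves G d level level-≤ level-edge

⌈m/2⌉≤n : ∀ {m n} → m ≤ 2 * n → ⌈ m /2⌉ ≤ n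
⌈m/2⌉≤n {m} {n} m≤2n = begin
  ⌈ m /2⌉           ≤⟨ ⌈n/2⌉-mono m≤2n ⟩
  ⌈ n + (n + 0) /2⌉ ≡⟨ cong (λ k → ⌈ n + k /2⌉) (+-identityʳ n) ⟩
  ⌈ n + n /2⌉       ≡⟨ sym (n≡⌈n+n/2⌉ n) ⟩
  n                 ∎
  where open ≤-Reasoning

mainTheorem11 : (n : ℕ) (G : Graph (suc n)) → Connected G →
                (d : ℕ) → HasDiameter G d →
                (r : ℕ) → IsOptRubblingNumber G r →
                ⌈ d + 2 /2⌉ ≤ r
mainTheorem11 n G _ d (_ , u , v , w , shortest) r ((p , solvable , refl) , _) =
  ⌈m/2⌉≤n (subst (_≤ 2 * size p) (+-comm 2 d) (geodesic⇒2+d≤2*size G w shortest p solvable))
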